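{- As $\mathbb{L}$-species, $\mathrm{Cay} = 1 + \int\bigl(E\cdot\mathrm{Prim}'\bigr)$.
   Context: A Cayley permutation of length $n$ is a word $w=w_1\cdots w_n$ of positive integers with $\{w_1,\dots,w_n\}=[k]$ for some $k\le n$; it is primitive if $n\ge1$ and $w_i\ne w_{i+1}$ for $1\le i\le n-1$. An $\mathbb{L}$-species assigns to each finite totally ordered set a finite set of structures, functorially in order-preserving bijections; isomorphic $\mathbb{L}$-species are written as equal. $\mathrm{Cay}$ and $\mathrm{Prim}$ are the $\mathbb{L}$-species of Cayley permutations and primitive Cayley permutations. $1$: one structure on the empty set only; $E$: one structure on every set. Sum is disjoint union; product $(F\cdot G)[\ell]=\bigsqcup_{\ell=\ell_1\sqcup\ell_2}F[\ell_1]\times G[\ell_2]$ over ordered pairs of complementary subsets; derivative $F'[\ell]=F[1\oplus\ell]$ ($\ell$ with a new minimum adjoined); integral $(\int F)[\emptyset]=\emptyset$, $(\int F)[\ell]=F[\ell\setminus\{\min\ell\}]$ for $\ell\ne\emptyset$. -}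

module Defs where

open import Data.Nat using (ℕ; zero; suc)
open import Data.Bool using (Bool; true; false; _∧_; _∨_; not; T)
open import Data.Fin using (Fin; _≟_)
open import Data.Fin.Subset using (Subset; ∁; ∣_∣)
open import Data.Vec using (Vec; []; _∷_)
import Data.List as List
open import Data.Unit using (⊤)
open import Data.Empty using (⊥)
open import Data.Sum using (_⊎_)
open import Data.Product using (Σ; _×_)
open import Relation.Nullary using (does)
open import Function.Bundles using (_↔_)

-- An L-species, presented skeletally: every finite totally ordered set of
-- size n is uniquely (order-)isomorphic to Fin n = {0 < 1 < ... < n-1}, so
-- an L-species is (up to isomorphism) the family of its structure sets on
-- the standard ordered sets [n].
Species : Set₁
Species = ℕ → Set

-- isomorphism of L-species (naturality is automatic: the only
-- order-preserving automorphism of [n] is the identity)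
_≅_ : Species → Species → Set
F ≅ G = (n : ℕ) → F n ↔ G n

infix 4 _≅_

𝟙 : Species
𝟙 zero    = ⊤
𝟙 (suc n) = ⊥

𝔼 : Species
𝔼 n = ⊤

_⊕_ : Species → Species → Species
(F ⊕ G) n = F n ⊎ G n

-- product: sum over ordered decompositions [n] = S ⊔ ∁S; each block, with
-- the induced order, is identified with [ |block| ]
_⊙_ : Species → Species → Species
(F ⊙ G) n = Σ (Subset n) (λ S → F ∣ S ∣ × G ∣ ∁ S ∣)

infixl 6 _⊕_
infixl 7 _⊙_

-- derivative: F'[ℓ] = F[1 ⊕ ℓ]
_′ : Species → Species
(F ′) n = F (suc n)

-- integral: (∫F)[∅] = ∅, (∫F)[ℓ] = F[ℓ ∖ {min ℓ}]
∫ : Species → Species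
∫ F zero    = ⊥
∫ F (suc n) = F n

-- Words over the alphabet [k] = {1,...,k}, encoded as Fin k (letter i+1 ↦ i).
occurs : {k n : ℕ} → Fin k → Vec (Fin k) n → Bool
occurs j []      = false
occurs j (x ∷ w) = does (x ≟ j) ∨ occurs j w

allB : {A : Set} → (A → Bool) → List.List A → Bool
allB p List.[]       = true
allB p (x List.∷ xs) = p x ∧ allB p xs

isCayley : {k n : ℕ} → Vec (Fin k) n → Bool
isCayley {k} w = allB (λ j → occurs j w) (List.allFin k)

adjDistinct : {k n : ℕ} → Vec (Fin k) n → Bool
adjDistinct []           = true
adjDistinct (x ∷ [])     = true
adjDistinct (x ∷ y ∷ w)  = not (does (x ≟ y)) ∧ adjDistinct (y ∷ w)

nonEmpty : {A : Set} {n : ℕ} → Vec A n → Bool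
nonEmpty []      = false
nonEmpty (_ ∷ _) = true

Cay : Species
Cay n = Σ ℕ (λ k → Σ (Vec (Fin k) n) (λ w → T (isCayley w)))

Prim : Species
Prim n = Σ ℕ (λ k → Σ (Vec (Fin k) n)
           (λ w → T (isCayley w ∧ nonEmpty w ∧ adjDistinct w)))

-- A nonempty Cayley permutation x w₁⋯wₙ is encoded by the set S of positions
-- i with wᵢ equal to its predecessor (w₀ = x) together with the word x r
-- obtained by deleting those positions. Deleting repeats keeps the set of
-- letters and leaves no two equal adjacent letters, so x r is a primitive
-- Cayley permutation on 1 ⊕ ∁S; any S is possible, and x w is recovered by
-- refilling each position of S with the letter before it.
module Submission where

open import Defs
open import Data.Nat using (ℕ; zero; suc)
open import Data.Bool using (Bool; true; false; _∧_; _∨_; T)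
open import Data.Bool.Properties using (∨-assoc; ∨-idem; T-∧; T-irrelevant)
open import Data.Fin using (Fin; _≟_)
open import Data.Fin.Subset using (Subset; ∁; ∣_∣)
open import Data.Vec using (Vec; []; _∷_)
open import Data.List using (List; []; _∷_; allFin)
open import Data.Unit using (⊤; tt)
open import Data.Empty using (⊥; ⊥-elim)
open import Data.Sum using (_⊎_; inj₁; inj₂; [_,_])
open import Data.Product using (Σ; _,_; proj₁; proj₂)
open import Function using (id; _∘_)
open import Function.Bundles using (_↔_; mk↔ₛ′; Equivalence)
open import Function.Properties.Inverse using (↔-sym; ↔-trans)
open import Relation.Nullary using (does; yes; no)
open import Relation.Binary.PropositionalEquality hiding ([_])

module _ {k : ℕ} where

  Runs : ℕ → Set
  Runs n = Σ (Subset n) λ S → Vec (Fin k) ∣ ∁ S ∣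

  compress : {n : ℕ} → Fin k → Vec (Fin k) n → Runs n
  compress x []      = [] , []
  compress x (y ∷ w) with x ≟ y
  ... | yes _ = let S , r = compress y w in true ∷ S , r
  ... | no _  = let S , r = compress y w in false ∷ S , y ∷ r

  expand : {n : ℕ} → Fin k → (S : Subset n) → Vec (Fin k) ∣ ∁ S ∣ → Vec (Fin k) n
  expand x []          []      = []
  expand x (true ∷ S)  r       = x ∷ expand x S r
  expand x (false ∷ S) (y ∷ r) = y ∷ expand y S r

  expand-compress : {n : ℕ} (x : Fin k) (w : Vec (Fin k) n) →
                    let S , r = compress x w in expand x S r ≡ w
  expand-compress x []      = refl
  expand-compress x (y ∷ w) with x ≟ y
  ... | yes refl = cong (x ∷_) (expand-compress x w)
  ... | no _     = cong (y ∷_) (expand-compress y w)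

  compress-expand : {n : ℕ} (x : Fin k) (S : Subset n) (r : Vec (Fin k) ∣ ∁ S ∣) →
                    T (adjDistinct (x ∷ r)) → compress x (expand x S r) ≡ (S , r)
  compress-expand x []          []      _ = refl
  compress-expand x (true ∷ S)  r       h with x ≟ x
  ... | yes _  rewrite compress-expand x S r h = refl
  ... | no x≢x = ⊥-elim (x≢x refl)
  compress-expand x (false ∷ S) (y ∷ r) h with x ≟ y
  ... | no _   rewrite compress-expand y S r h = refl

  adjDistinct-∷ : {m : ℕ} {x y : Fin k} {r : Vec (Fin k) m} →
                 x ≢ y → T (adjDistinct (y ∷ r)) → T (adjDistinct (x ∷ y ∷ r))
  adjDistinct-∷ {x = x} {y} x≢y h with x ≟ y
  ... | yes x≡y = ⊥-elim (x≢y x≡y)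
  ... | no _    = h

  adjDistinct-compress : {n : ℕ} (x : Fin k) (w : Vec (Fin k) n) →
                         T (adjDistinct (x ∷ proj₂ (compress x w)))
  adjDistinct-compress x []      = tt
  adjDistinct-compress x (y ∷ w) with x ≟ y
  ... | yes refl = adjDistinct-compress x w
  ... | no x≢y   = adjDistinct-∷ {r = proj₂ (compress y w)} x≢y (adjDistinct-compress y w)

  occurs-expand : {n : ℕ} (j x : Fin k) (S : Subset n) (r : Vec (Fin k) ∣ ∁ S ∣) →
                  occurs j (x ∷ expand x S r) ≡ occurs j (x ∷ r)
  occurs-expand j x []          []      = refl
  occurs-expand j x (true ∷ S)  r       = begin
    x=j ∨ (x=j ∨ rest)  ≡⟨ sym (∨-assoc x=j x=j rest) ⟩
    (x=j ∨ x=j) ∨ rest  ≡⟨ cong (_∨ rest) (∨-idem x=j) ⟩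
    x=j ∨ rest          ≡⟨ occurs-expand j x S r ⟩
    occurs j (x ∷ r)    ∎
    where open ≡-Reasoning
          x=j  = does (x ≟ j)
          rest = occurs j (expand x S r)
  occurs-expand j x (false ∷ S) (y ∷ r) = cong (does (x ≟ j) ∨_) (occurs-expand j y S r)

allB-cong : {A : Set} {p q : A → Bool} → (∀ a → p a ≡ q a) → (xs : List A) → allB p xs ≡ allB q xs
allB-cong p≗q []       = refl
allB-cong p≗q (x ∷ xs) = cong₂ _∧_ (p≗q x) (allB-cong p≗q xs)

isCayley-expand : {k n : ℕ} (x : Fin k) (S : Subset n) (r : Vec (Fin k) ∣ ∁ S ∣) →
                  isCayley (x ∷ expand x S r) ≡ isCayley (x ∷ r)
isCayley-expand {k} x S r = allB-cong (λ j → occurs-expand j x S r) (allFin k)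

isCayley-compress : {k n : ℕ} (x : Fin k) (w : Vec (Fin k) n) →
                    isCayley (x ∷ proj₂ (compress x w)) ≡ isCayley (x ∷ w)
isCayley-compress x w = begin
  isCayley (x ∷ r)             ≡⟨ sym (isCayley-expand x S r) ⟩
  isCayley (x ∷ expand x S r)  ≡⟨ cong (isCayley ∘ (x ∷_)) (expand-compress x w) ⟩
  isCayley (x ∷ w)             ∎
  where open ≡-Reasoning
        S = proj₁ (compress x w)
        r = proj₂ (compress x w)

Cay-≡ : {n k : ℕ} {v w : Vec (Fin k) n} {p : T (isCayley v)} {q : T (isCayley w)} →
        v ≡ w → _≡_ {A = Cay n} (k , v , p) (k , w , q)
Cay-≡ {n} {k} {w = w} refl = cong {B = Cay n} (λ p → k , w , p) (T-irrelevant _ _)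

Cay-zero↔⊤ : Cay zero ↔ ⊤
Cay-zero↔⊤ = mk↔ₛ′ (λ _ → tt) (λ _ → zero , [] , tt) (λ _ → refl) emptyWord
  where
  emptyWord : (c : Cay zero) → (zero , [] , tt) ≡ c
  emptyWord (zero , [] , tt) = refl
  emptyWord (suc k , [] , ())

runDecomposition : {n k : ℕ} (x : Fin k) (c : Runs n) →
                   T (isCayley (x ∷ proj₂ c) ∧ adjDistinct (x ∷ proj₂ c)) → (𝔼 ⊙ Prim ′) n
runDecomposition {k = k} x (S , r) p = S , tt , k , x ∷ r , p

runDecomposition-cong : {n k : ℕ} (x : Fin k) {c d : Runs n} → c ≡ d → ∀ {p q} →
                        runDecomposition x c p ≡ runDecomposition x d q
runDecomposition-cong x {c} refl = cong (runDecomposition x c) (T-irrelevant _ _)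

splitRuns : {n : ℕ} → Cay (suc n) → (𝔼 ⊙ Prim ′) n
splitRuns (k , x ∷ w , cay) = runDecomposition x (compress x w)
  (Equivalence.from T-∧ (subst T (sym (isCayley-compress x w)) cay , adjDistinct-compress x w))

joinRuns : {n : ℕ} → (𝔼 ⊙ Prim ′) n → Cay (suc n)
joinRuns (S , tt , k , x ∷ r , p) =
  k , x ∷ expand x S r , subst T (sym (isCayley-expand x S r)) (proj₁ (Equivalence.to T-∧ p))

Cay-suc↔𝔼⊙Prim′ : (n : ℕ) → Cay (suc n) ↔ (𝔼 ⊙ Prim ′) n
Cay-suc↔𝔼⊙Prim′ n = mk↔ₛ′ splitRuns joinRuns split∘join join∘split
  where
  split∘join : (c : (𝔼 ⊙ Prim ′) n) → splitRuns (joinRuns c) ≡ c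
  split∘join (S , tt , k , x ∷ r , p) =
    runDecomposition-cong x (compress-expand x S r (proj₂ (Equivalence.to T-∧ p)))

  join∘split : (c : Cay (suc n)) → joinRuns (splitRuns c) ≡ c
  join∘split (k , x ∷ w , cay) = Cay-≡ (cong (x ∷_) (expand-compress x w))

⊥-⊎-identityˡ : (A : Set) → (⊥ ⊎ A) ↔ A
⊥-⊎-identityˡ A = mk↔ₛ′ [ ⊥-elim , id ] inj₂ (λ _ → refl) λ { (inj₂ _) → refl }

⊥-⊎-identityʳ : (A : Set) → (A ⊎ ⊥) ↔ A
⊥-⊎-identityʳ A = mk↔ₛ′ [ id , ⊥-elim ] inj₁ (λ _ → refl) λ { (inj₁ _) → refl }

lemma7p1 : Cay ≅ 𝟙 ⊕ ∫ (𝔼 ⊙ (Prim ′))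
lemma7p1 zero    = ↔-trans Cay-zero↔⊤ (↔-sym (⊥-⊎-identityʳ ⊤))
lemma7p1 (suc n) = ↔-trans (Cay-suc↔𝔼⊙Prim′ n) (↔-sym (⊥-⊎-identityˡ _))
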